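{- Let $P$ be a periodic dealing pattern with period $p$ (i.e. $P_{i+p}=P_i$ for all $i$). Then for every $N\ge p$ and every $1\le k\le N$, writing $j=J^P_{N-|P_p|_D,\;k-|P_p|_D}$ whenever $d_k(P)>p$, \[J^{P}_{N,k}=\begin{cases} d_k(P), & \text{if } d_k(P)\le p,\\ j+p, & \text{if } d_k(P)>p \text{ and } j\le N-p,\\ u_{p-N+j}(P), & \text{otherwise.}\end{cases}\]
   Context: A dealing pattern $P=P_1P_2P_3\cdots$ is an infinite sequence of letters $U$ and $D$ containing infinitely many $D$'s. Dealing a deck of $N$ cards (positions $1,\dots,N$ from the top) by $P$ means: process the letters in order; for a $U$ move the top card to the bottom; for a $D$ remove the top card (deal it); stop when all $N$ cards are dealt. For $1\le k\le N$, $J^P_{N,k}$ is the initial position of the $k$th card dealt. $d_i(P)$, $u_i(P)$ denote the index (starting from 1) of the $i$th occurrence of $D$, resp. $U$, in $P$. $|P_p|_D$ is the number of $D$'s among the first $p$ letters of $P$. -}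

module Defs where

open import Data.Nat using (ℕ; zero; suc; _+_; _∸_; _≤_; _<_)
open import Data.Product using (_×_; _,_; ∃-syntax; proj₁)
open import Data.List using (List; []; _∷_; _++_; [_])
open import Relation.Binary.PropositionalEquality using (_≡_)

data Letter : Set where
  U D : Letter

-- A dealing pattern P = P₁P₂P₃⋯ is stored 0-indexed:
-- (letter i) is the paper's P_{i+1}.  It must contain infinitely many D's.
record DealingPattern : Set where
  field
    letter : ℕ → Letter
    infD   : ∀ n → ∃[ i ] (n ≤ i × letter i ≡ D)
open DealingPattern public

isD : Letter → ℕ
isD U = 0
isD D = 1

isU : Letter → ℕ
isU U = 1
isU D = 0

countD : (ℕ → Letter) → ℕ → ℕ
countD P zero    = 0
countD P (suc n) = countD P n + isD (P n)

countU : (ℕ → Letter) → ℕ → ℕ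
countU P zero    = 0
countU P (suc n) = countU P n + isU (P n)

searchD : (ℕ → Letter) → ℕ → ℕ → ℕ
searchD P n zero    = n
searchD P n (suc f) with P n
... | D = n
... | U = searchD P (suc n) f

nextD : DealingPattern → ℕ → ℕ
nextD P n = searchD (letter P) n (suc (proj₁ (infD P n) ∸ n))

-- 0-indexed position of the (i+1)-th D
posD : DealingPattern → ℕ → ℕ
posD P zero    = nextD P 0
posD P (suc i) = nextD P (suc (posD P i))

-- d_k(P): 1-indexed position of the k-th D (k ≥ 1; value at k = 0 is junk)
dIdx : DealingPattern → ℕ → ℕ
dIdx P k = suc (posD P (k ∸ 1))

-- "x = u_m(P)": x is the (1-indexed) position of the m-th U in P.
IsUIdx : (ℕ → Letter) → ℕ → ℕ → Set
IsUIdx P m x = 1 ≤ x × P (x ∸ 1) ≡ U × countU P x ≡ m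

-- Dealing simulation. State: (deck from top to bottom, dealt cards in order).
State : Set
State = List ℕ × List ℕ

step : Letter → State → State
step _ ([] , dealt)     = ([] , dealt)
step U (x ∷ xs , dealt) = (xs ++ [ x ] , dealt)
step D (x ∷ xs , dealt) = (xs , dealt ++ [ x ])

run : (ℕ → Letter) → ℕ → ℕ → State → State
run P i zero    s = s
run P i (suc t) s = run P (suc i) t (step (P i) s)

deckFrom : ℕ → ℕ → List ℕ
deckFrom a zero    = []
deckFrom a (suc n) = a ∷ deckFrom (suc a) n

-- k-th element (1-indexed) of a list, 0 if absent
nth : List ℕ → ℕ → ℕ
nth []       _             = 0
nth (x ∷ xs) zero          = 0
nth (x ∷ xs) (suc zero)    = x
nth (x ∷ xs) (suc (suc k)) = nth xs (suc k)

-- J^P_{N,k}: initial position of the k-th dealt card when dealing N cards.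
-- All N cards are dealt exactly when the N-th D (letter d_N(P)) is processed,
-- so the process is run for d_N(P) letters.
J : DealingPattern → ℕ → ℕ → ℕ
J P N k = nth (Data.Product.proj₂ (run (letter P) 0 (dIdx P N) (deckFrom 1 N , []))) k

{-# OPTIONS --safe #-}
module Submission where

-- After the first p letters of P, dealing N ≥ p cards leaves the deck p+1, …, N followed by
-- the positions of the U's among P₁⋯P_p (in order), and the dealt pile consists of the
-- positions of the D's among them. By periodicity the remaining letters deal this deck of
-- N − |P_p|_D cards exactly as P deals a fresh deck of that size, so the later cards are the
-- cards lying at positions J_{N−|P_p|_D, k−|P_p|_D} of that deck.

open import Defs
open import Data.Nat using (ℕ; zero; suc; _+_; _∸_; _≤_; _<_; z≤n; s≤s; _≤?_)
open import Data.Nat.Properties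
open import Data.Product using (_×_; _,_; proj₁; proj₂; ∃-syntax)
open import Data.Sum using (inj₁; inj₂)
open import Data.List using (List; []; _∷_; _++_; [_]; map; length)
open import Data.List.Properties using (map-++; ++-assoc; ++-identityʳ; length-++)
open import Data.List.Relation.Unary.All using (All; []; _∷_)
open import Data.List.Relation.Unary.All.Properties using (++⁺)
open import Relation.Binary.PropositionalEquality hiding ([_]; J)
open import Relation.Nullary using (yes; no)
open import Relation.Nullary.Negation using (contradiction)
open ≡-Reasoning

_≼_ : List ℕ → List ℕ → Set
xs ≼ ys = ∃[ zs ] ys ≡ xs ++ zs

≼-refl : ∀ xs → xs ≼ xs
≼-refl xs = [] , sym (++-identityʳ xs)

≼-trans : ∀ {xs ys zs} → xs ≼ ys → ys ≼ zs → xs ≼ zs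
≼-trans {xs} (us , refl) (vs , refl) = us ++ vs , ++-assoc xs us vs

≼-length : ∀ {xs ys} → xs ≼ ys → length xs ≤ length ys
≼-length {xs} (zs , refl) = subst (length xs ≤_) (sym (length-++ xs)) (m≤m+n _ _)

nth-zero : ∀ xs → nth xs 0 ≡ 0
nth-zero []      = refl
nth-zero (_ ∷ _) = refl

nth-++ˡ : ∀ xs ys {k} → k ≤ length xs → nth (xs ++ ys) k ≡ nth xs k
nth-++ˡ []       ys {zero}        _        = nth-zero ys
nth-++ˡ (x ∷ xs) ys {zero}        _        = refl
nth-++ˡ (x ∷ xs) ys {suc zero}    _        = refl
nth-++ˡ (x ∷ xs) ys {suc (suc k)} (s≤s k≤) = nth-++ˡ xs ys k≤

nth-++ʳ : ∀ xs ys {k} → length xs < k → nth (xs ++ ys) k ≡ nth ys (k ∸ length xs)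
nth-++ʳ []       ys               _              = refl
nth-++ʳ (x ∷ xs) ys {suc zero}    (s≤s ())
nth-++ʳ (x ∷ xs) ys {suc (suc k)} (s≤s xs<1+k) = nth-++ʳ xs ys xs<1+k

nth-≼ : ∀ {xs ys k} → xs ≼ ys → k ≤ length xs → nth ys k ≡ nth xs k
nth-≼ {xs} (zs , refl) = nth-++ˡ xs zs

nth-snoc : ∀ xs y → nth (xs ++ [ y ]) (suc (length xs)) ≡ y
nth-snoc []       y = refl
nth-snoc (x ∷ xs) y = nth-snoc xs y

nth-map : ∀ f → f 0 ≡ 0 → ∀ xs k → nth (map f xs) k ≡ f (nth xs k)
nth-map f f0 []       k             = sym f0
nth-map f f0 (x ∷ xs) zero          = sym f0
nth-map f f0 (x ∷ xs) (suc zero)    = refl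
nth-map f f0 (x ∷ xs) (suc (suc k)) = nth-map f f0 xs (suc k)

nth-All : ∀ {Q : ℕ → Set} {xs k} → All Q xs → 1 ≤ k → k ≤ length xs → Q (nth xs k)
nth-All {k = suc zero}    (qx ∷ _)  _ _        = qx
nth-All {k = suc (suc k)} (_ ∷ qxs) _ (s≤s k≤) = nth-All qxs (s≤s z≤n) k≤

length-deckFrom : ∀ a n → length (deckFrom a n) ≡ n
length-deckFrom a zero    = refl
length-deckFrom a (suc n) = cong suc (length-deckFrom (suc a) n)

nth-deckFrom : ∀ a {n i} → i < n → nth (deckFrom a n) (suc i) ≡ a + i
nth-deckFrom a {suc n} {zero}  _       = sym (+-identityʳ a)
nth-deckFrom a {suc n} {suc i} (s≤s i<n) = trans (nth-deckFrom (suc a) i<n) (sym (+-suc a i))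

All-deckFrom : ∀ {lo hi} a n → lo ≤ a → a + n ≤ hi → All (λ x → lo ≤ x × x < hi) (deckFrom a n)
All-deckFrom a zero    _    _    = []
All-deckFrom {hi = hi} a (suc n) lo≤a a+n≤ =
  (lo≤a , <-≤-trans (m<m+n a (s≤s z≤n)) a+n≤)
    ∷ All-deckFrom (suc a) n (m≤n⇒m≤1+n lo≤a) (subst (_≤ hi) (+-suc a n) a+n≤)

map-nth-deckFrom : ∀ xs → map (nth xs) (deckFrom 1 (length xs)) ≡ xs
map-nth-deckFrom []       = refl
map-nth-deckFrom (x ∷ xs) = cong (x ∷_) (trans (drop-head 0 (length xs)) (map-nth-deckFrom xs))
  where
    drop-head : ∀ a n → map (nth (x ∷ xs)) (deckFrom (2 + a) n) ≡ map (nth xs) (deckFrom (1 + a) n)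
    drop-head a zero    = refl
    drop-head a (suc n) = cong (nth xs (suc a) ∷_) (drop-head (suc a) n)

initial : ℕ → State
initial N = (deckFrom 1 N , [])

dealt : State → List ℕ
dealt = proj₂

cardCount : State → ℕ
cardCount (deck , pile) = length deck + length pile

AllCards : (ℕ → Set) → State → Set
AllCards Q (deck , pile) = All Q deck × All Q pile

relabel : (ℕ → ℕ) → List ℕ → State → State
relabel f ys (deck , pile) = (map f deck , ys ++ map f pile)

relabel-initial : ∀ xs ys → relabel (nth xs) ys (initial (length xs)) ≡ (xs , ys)
relabel-initial xs ys = cong₂ _,_ (map-nth-deckFrom xs) (++-identityʳ ys)

step-relabel : ∀ f ys l s → step l (relabel f ys s) ≡ relabel f ys (step l s)
step-relabel f ys U ([] , _)       = refl
step-relabel f ys D ([] , _)       = refl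
step-relabel f ys U (x ∷ xs , zs) = cong (_, ys ++ map f zs) (sym (map-++ f xs [ x ]))
step-relabel f ys D (x ∷ xs , zs) = cong (map f xs ,_) (begin
  (ys ++ map f zs) ++ [ f x ] ≡⟨ ++-assoc ys (map f zs) [ f x ] ⟩
  ys ++ (map f zs ++ [ f x ]) ≡⟨ cong (ys ++_) (sym (map-++ f zs [ x ])) ⟩
  ys ++ map f (zs ++ [ x ])   ∎)

step-dealt : ∀ l s → dealt s ≼ dealt (step l s)
step-dealt U ([] , zs)    = ≼-refl zs
step-dealt D ([] , zs)    = ≼-refl zs
step-dealt U (_ ∷ _ , zs) = ≼-refl zs
step-dealt D (x ∷ _ , zs) = [ x ] , refl

step-cardCount : ∀ l s → cardCount (step l s) ≡ cardCount s
step-cardCount U ([] , _)       = refl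
step-cardCount D ([] , _)       = refl
step-cardCount U (x ∷ xs , zs) = cong (_+ length zs) (trans (length-++ xs) (+-comm (length xs) 1))
step-cardCount D (x ∷ xs , zs) =
  trans (cong (length xs +_) (trans (length-++ zs) (+-comm (length zs) 1))) (+-suc (length xs) (length zs))

length-dealt-step : ∀ l s → length (dealt s) + isD l ≤ cardCount s
                  → length (dealt (step l s)) ≡ length (dealt s) + isD l
length-dealt-step U ([] , zs)     _    = sym (+-identityʳ _)
length-dealt-step U (_ ∷ _ , zs)  _    = sym (+-identityʳ _)
length-dealt-step D ([] , zs)     full = contradiction full (m+1+n≰m (length zs))
length-dealt-step D (x ∷ _ , zs)  _    = length-++ zs

step-All : ∀ {Q} l s → AllCards Q s → AllCards Q (step l s)
step-All U ([] , _)    qs                = qs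
step-All D ([] , _)    qs                = qs
step-All U (_ ∷ _ , _) (qx ∷ qxs , qzs) = ++⁺ qxs (qx ∷ []) , qzs
step-All D (_ ∷ _ , _) (qx ∷ qxs , qzs) = qxs , ++⁺ qzs (qx ∷ [])

whenU : Letter → ℕ → List ℕ
whenU U x = [ x ]
whenU D x = []

whenD : Letter → ℕ → List ℕ
whenD U x = []
whenD D x = [ x ]

step-top : ∀ l x m us ds → step l (x ∷ deckFrom (suc x) m ++ us , ds)
                         ≡ (deckFrom (suc x) m ++ (us ++ whenU l x) , ds ++ whenD l x)
step-top U x m us ds = cong₂ _,_ (++-assoc (deckFrom (suc x) m) us [ x ]) (sym (++-identityʳ ds))
step-top D x m us ds = cong (_, ds ++ [ x ]) (cong (deckFrom (suc x) m ++_) (sym (++-identityʳ us)))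

module Dealing (L : ℕ → Letter) where

  run-+ : ∀ a b i s → run L i (a + b) s ≡ run L (i + a) b (run L i a s)
  run-+ zero    b i s rewrite +-identityʳ i = refl
  run-+ (suc a) b i s rewrite run-+ a b (suc i) (step (L i) s) | +-suc i a = refl

  run-suc : ∀ t i s → run L i (suc t) s ≡ step (L (i + t)) (run L i t s)
  run-suc zero    i s rewrite +-identityʳ i = refl
  run-suc (suc t) i s rewrite run-suc t (suc i) (step (L i) s) | +-suc i t = refl

  run-periodic : ∀ p → (∀ i → L (i + p) ≡ L i) → ∀ t i s → run L (i + p) t s ≡ run L i t s
  run-periodic p periodic zero    i s = refl
  run-periodic p periodic (suc t) i s rewrite periodic i = run-periodic p periodic t (suc i) (step (L i) s)

  run-relabel : ∀ f ys t i s → run L i t (relabel f ys s) ≡ relabel f ys (run L i t s)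
  run-relabel f ys zero    i s = refl
  run-relabel f ys (suc t) i s =
    trans (cong (run L (suc i) t) (step-relabel f ys (L i) s)) (run-relabel f ys t (suc i) (step (L i) s))

  run-dealt : ∀ t i s → dealt s ≼ dealt (run L i t s)
  run-dealt zero    i s = ≼-refl (dealt s)
  run-dealt (suc t) i s = ≼-trans (step-dealt (L i) s) (run-dealt t (suc i) (step (L i) s))

  run-cardCount : ∀ t i s → cardCount (run L i t s) ≡ cardCount s
  run-cardCount zero    i s = refl
  run-cardCount (suc t) i s = trans (run-cardCount t (suc i) (step (L i) s)) (step-cardCount (L i) s)

  run-All : ∀ {Q} t i s → AllCards Q s → AllCards Q (run L i t s)
  run-All zero    i s qs = qs
  run-All (suc t) i s qs = run-All t (suc i) (step (L i) s) (step-All (L i) s qs)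

  dealtAfter : ℕ → ℕ → List ℕ
  dealtAfter N t = dealt (run L 0 t (initial N))

  dealtAfter-≼ : ∀ N {s t} → s ≤ t → dealtAfter N s ≼ dealtAfter N t
  dealtAfter-≼ N {s} {t} s≤t = subst (λ u → dealtAfter N s ≼ dealtAfter N u) (m+[n∸m]≡n s≤t) extends
    where
      extends : dealtAfter N s ≼ dealtAfter N (s + (t ∸ s))
      extends rewrite run-+ s (t ∸ s) 0 (initial N) = run-dealt (t ∸ s) s (run L 0 s (initial N))

  length-dealtAfter : ∀ N t → countD L t ≤ N → length (dealtAfter N t) ≡ countD L t
  length-dealtAfter N zero    _        = refl
  length-dealtAfter N (suc t) dealable rewrite run-suc t 0 (initial N) =
    trans (length-dealt-step (L t) s (subst₂ _≤_ (cong (_+ isD (L t)) (sym ih)) (sym size) dealable))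
          (cong (_+ isD (L t)) ih)
    where
      s : State
      s = run L 0 t (initial N)
      ih : length (dealt s) ≡ countD L t
      ih = length-dealtAfter N t (m+n≤o⇒m≤o (countD L t) dealable)
      size : cardCount s ≡ N
      size = trans (run-cardCount t 0 (initial N)) (trans (+-identityʳ _) (length-deckFrom 1 N))

  dealtAfter-range : ∀ N t → All (λ x → 1 ≤ x × x < suc N) (dealtAfter N t)
  dealtAfter-range N t = proj₂ (run-All t 0 (initial N) (All-deckFrom 1 N ≤-refl ≤-refl , []))

  positionsU : ℕ → List ℕ
  positionsU zero    = []
  positionsU (suc t) = positionsU t ++ whenU (L t) (suc t)

  positionsD : ℕ → List ℕ
  positionsD zero    = []
  positionsD (suc t) = positionsD t ++ whenD (L t) (suc t)

  length-positionsU : ∀ t → length (positionsU t) ≡ countU L t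
  length-positionsU zero    = refl
  length-positionsU (suc t) = trans (length-++ (positionsU t)) (cong₂ _+_ (length-positionsU t) (length-whenU (L t)))
    where
      length-whenU : ∀ l → length (whenU l (suc t)) ≡ isU l
      length-whenU U = refl
      length-whenU D = refl

  length-positionsD : ∀ t → length (positionsD t) ≡ countD L t
  length-positionsD zero    = refl
  length-positionsD (suc t) = trans (length-++ (positionsD t)) (cong₂ _+_ (length-positionsD t) (length-whenD (L t)))
    where
      length-whenD : ∀ l → length (whenD l (suc t)) ≡ isD l
      length-whenD U = refl
      length-whenD D = refl

  countU+countD : ∀ t → countU L t + countD L t ≡ t
  countU+countD zero = refl
  countU+countD (suc t) with L t
  ... | U = trans (cong₂ _+_ (+-comm (countU L t) 1) (+-identityʳ _)) (cong suc (countU+countD t))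
  ... | D = trans (cong₂ _+_ (+-identityʳ _) (+-comm (countD L t) 1))
                  (trans (+-suc (countU L t) (countD L t)) (cong suc (countU+countD t)))

  positionsD-≼ : ∀ {s t} → s ≤ t → positionsD s ≼ positionsD t
  positionsD-≼ {t = zero}  z≤n = ≼-refl []
  positionsD-≼ {t = suc t} s≤t with m≤n⇒m<n∨m≡n s≤t
  ... | inj₁ s<1+t = ≼-trans (positionsD-≼ (≤-pred s<1+t)) (whenD (L t) (suc t) , refl)
  ... | inj₂ refl  = ≼-refl _

  countD-mono : ∀ {s t} → s ≤ t → countD L s ≤ countD L t
  countD-mono {s} {t} s≤t =
    subst₂ _≤_ (length-positionsD s) (length-positionsD t) (≼-length (positionsD-≼ s≤t))

  nth-positionsD : ∀ {y t} → y < t → L y ≡ D → nth (positionsD t) (countD L (suc y)) ≡ suc y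
  nth-positionsD {y} {t} y<t Ly = begin
    nth (positionsD t) (countD L (suc y))       ≡⟨ nth-≼ (positionsD-≼ y<t) (≤-reflexive (sym (length-positionsD (suc y)))) ⟩
    nth (positionsD (suc y)) (countD L (suc y)) ≡⟨ last ⟩
    suc y                                        ∎
    where
      last : nth (positionsD (suc y)) (countD L (suc y)) ≡ suc y
      last rewrite Ly | +-comm (countD L y) 1 | sym (length-positionsD y) = nth-snoc (positionsD y) (suc y)

  nth-positionsU : ∀ t {m} → 1 ≤ m → m ≤ countU L t → IsUIdx L m (nth (positionsU t) m)
  nth-positionsU zero    1≤m m≤0 = contradiction m≤0 (<⇒≱ 1≤m)
  nth-positionsU (suc t) {m} 1≤m m≤ with m ≤? countU L t
  ... | yes m≤cu = subst (IsUIdx L m)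
                     (sym (nth-++ˡ (positionsU t) _ (subst (m ≤_) (sym (length-positionsU t)) m≤cu)))
                     (nth-positionsU t 1≤m m≤cu)
  ... | no m≰cu with L t in Lt
  ...   | D = contradiction (subst (m ≤_) (+-identityʳ _) m≤) m≰cu
  ...   | U = subst (IsUIdx L m) (sym last) (s≤s z≤n , Lt , trans counted (sym m≡))
    where
      m≡ : m ≡ suc (countU L t)
      m≡ = ≤-antisym (subst (m ≤_) (+-comm (countU L t) 1) m≤) (≰⇒> m≰cu)
      last : nth (positionsU t ++ [ suc t ]) m ≡ suc t
      last rewrite m≡ | sym (length-positionsU t) = nth-snoc (positionsU t) (suc t)
      counted : countU L t + isU (L t) ≡ suc (countU L t)
      counted = trans (cong (λ l → countU L t + isU l) Lt) (+-comm (countU L t) 1)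

  deckAfter : ℕ → ℕ → List ℕ
  deckAfter N t = deckFrom (suc t) (N ∸ t) ++ positionsU t

  run-initial : ∀ N t → t ≤ N → run L 0 t (initial N) ≡ (deckAfter N t , positionsD t)
  run-initial N zero    _   = cong (_, []) (sym (++-identityʳ _))
  run-initial N (suc t) t<N rewrite run-suc t 0 (initial N) | run-initial N t (<⇒≤ t<N) | +-∸-assoc 1 t<N =
    step-top (L t) (suc t) (N ∸ suc t) (positionsU t) (positionsD t)

  ∸+countU : ∀ {N t} → t ≤ N → (N ∸ t) + countU L t ≡ N ∸ countD L t
  ∸+countU {N} {t} t≤N = begin
    (N ∸ t) + cu               ≡⟨ sym (m+n∸n≡m _ cd) ⟩
    (N ∸ t) + cu + cd ∸ cd     ≡⟨ cong (_∸ cd) (+-assoc (N ∸ t) cu cd) ⟩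
    (N ∸ t) + (cu + cd) ∸ cd   ≡⟨ cong (λ x → (N ∸ t) + x ∸ cd) (countU+countD t) ⟩
    (N ∸ t) + t ∸ cd           ≡⟨ cong (_∸ cd) (m∸n+n≡m t≤N) ⟩
    N ∸ cd                     ∎
    where
      cu = countU L t
      cd = countD L t

  length-deckAfter : ∀ {N t} → t ≤ N → length (deckAfter N t) ≡ N ∸ countD L t
  length-deckAfter {N} {t} t≤N =
    trans (length-++ (deckFrom (suc t) (N ∸ t)))
          (trans (cong₂ _+_ (length-deckFrom (suc t) (N ∸ t)) (length-positionsU t)) (∸+countU t≤N))

  nth-deckAfter-kept : ∀ {N t i} → 1 ≤ i → i ≤ N ∸ t → nth (deckAfter N t) i ≡ i + t
  nth-deckAfter-kept {N} {t} {suc i} _ i<N∸t = begin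
    nth (deckAfter N t) (suc i)             ≡⟨ nth-++ˡ (deckFrom (suc t) (N ∸ t)) (positionsU t)
                                                  (subst (suc i ≤_) (sym (length-deckFrom _ _)) i<N∸t) ⟩
    nth (deckFrom (suc t) (N ∸ t)) (suc i)  ≡⟨ nth-deckFrom (suc t) i<N∸t ⟩
    suc (t + i)                             ≡⟨ cong suc (+-comm t i) ⟩
    suc (i + t)                             ∎

  nth-deckAfter-moved : ∀ {N t i} → t ≤ N → N ∸ t < i → i ≤ N ∸ countD L t
                      → IsUIdx L ((t + i) ∸ N) (nth (deckAfter N t) i)
  nth-deckAfter-moved {N} {t} {i} t≤N N∸t<i i≤ =
    subst₂ (IsUIdx L) (sym offset) (sym moved)
      (nth-positionsU t (m<n⇒0<n∸m N∸t<i) (subst (i ∸ (N ∸ t) ≤_) (m+n∸m≡n (N ∸ t) (countU L t))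
        (∸-monoˡ-≤ (N ∸ t) (subst (i ≤_) (sym (∸+countU t≤N)) i≤))))
    where
      offset : (t + i) ∸ N ≡ i ∸ (N ∸ t)
      offset = trans (cong ((t + i) ∸_) (sym (m+[n∸m]≡n t≤N))) ([m+n]∸[m+o]≡n∸o t i (N ∸ t))
      moved : nth (deckAfter N t) i ≡ nth (positionsU t) (i ∸ (N ∸ t))
      moved = trans (nth-++ʳ (deckFrom (suc t) (N ∸ t)) (positionsU t)
                      (subst (_< i) (sym (length-deckFrom (suc t) (N ∸ t))) N∸t<i))
                    (cong (λ n → nth (positionsU t) (i ∸ n)) (length-deckFrom (suc t) (N ∸ t)))

  searchD-finds : ∀ f n {w} → n ≤ w → w < n + f → L w ≡ D
                → L (searchD L n f) ≡ D × countD L (searchD L n f) ≡ countD L n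
  searchD-finds zero    n {w} n≤w w<n+0 _ = contradiction (subst (w <_) (+-identityʳ n) w<n+0) (≤⇒≯ n≤w)
  searchD-finds (suc f) n {w} n≤w w< Lw with L n in Ln
  ... | D = Ln , refl
  ... | U with searchD-finds f (suc n) (≤∧≢⇒< n≤w n≢w) (subst (w <_) (+-suc n f) w<) Lw
    where
      n≢w : n ≢ w
      n≢w refl with trans (sym Ln) Lw
      ... | ()
  ...   | found , counted = found , trans counted (trans (cong (λ l → countD L n + isD l) Ln) (+-identityʳ _))

module _ (P : DealingPattern) where
  open Dealing (letter P)
  private
    L = letter P

  nextD-finds : ∀ n → L (nextD P n) ≡ D × countD L (nextD P n) ≡ countD L n
  nextD-finds n with infD P n
  ... | w , n≤w , Lw = searchD-finds (suc (w ∸ n)) n n≤w w<bound Lw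
    where
      w<bound : w < n + suc (w ∸ n)
      w<bound = subst (w <_) (sym (trans (+-suc n (w ∸ n)) (cong suc (m+[n∸m]≡n n≤w)))) ≤-refl

  posD-finds : ∀ i → L (posD P i) ≡ D × countD L (posD P i) ≡ i
  posD-finds zero = nextD-finds 0
  posD-finds (suc i) with nextD-finds (suc (posD P i)) | posD-finds i
  ... | found , counted | foundᵢ , countedᵢ =
    found , trans counted (trans (cong₂ (λ a l → a + isD l) countedᵢ foundᵢ) (+-comm i 1))

  countD-dIdx : ∀ k → countD L (dIdx P (suc k)) ≡ suc k
  countD-dIdx k =
    trans (cong₂ (λ a l → a + isD l) (proj₂ (posD-finds k)) (proj₁ (posD-finds k))) (+-comm k 1)

  dIdx≤⇒≤countD : ∀ {k t} → dIdx P (suc k) ≤ t → suc k ≤ countD L t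
  dIdx≤⇒≤countD {k} {t} d≤t = subst (_≤ countD L t) (countD-dIdx k) (countD-mono d≤t)

  <dIdx⇒countD< : ∀ {k t} → t < dIdx P (suc k) → countD L t < suc k
  <dIdx⇒countD< {k} t<d = s≤s (subst (_ ≤_) (proj₂ (posD-finds k)) (countD-mono (≤-pred t<d)))

  nth-positionsD-dIdx : ∀ {k t} → dIdx P (suc k) ≤ t → nth (positionsD t) (suc k) ≡ dIdx P (suc k)
  nth-positionsD-dIdx {k} {t} d≤t =
    subst (λ i → nth (positionsD t) i ≡ dIdx P (suc k)) (countD-dIdx k) (nth-positionsD d≤t (proj₁ (posD-finds k)))

  length-dealtAfter-dIdx : ∀ N → N ≤ length (dealtAfter N (dIdx P N))
  length-dealtAfter-dIdx zero    = z≤n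
  length-dealtAfter-dIdx (suc N) =
    ≤-reflexive (sym (trans (length-dealtAfter (suc N) _ (≤-reflexive (countD-dIdx N))) (countD-dIdx N)))

  J-dealtAfter : ∀ {N k t} → k ≤ N → dIdx P N ≤ t → J P N k ≡ nth (dealtAfter N t) k
  J-dealtAfter {N} k≤N d≤t = sym (nth-≼ (dealtAfter-≼ N d≤t) (≤-trans k≤N (length-dealtAfter-dIdx N)))

  J-range : ∀ {N k} → 1 ≤ k → k ≤ N → 1 ≤ J P N k × J P N k ≤ N
  J-range {N} 1≤k k≤N with nth-All (dealtAfter-range N (dIdx P N)) 1≤k (≤-trans k≤N (length-dealtAfter-dIdx N))
  ... | 1≤J , J<1+N = 1≤J , ≤-pred J<1+N

module Periodic (P : DealingPattern) (p : ℕ) (periodic : ∀ i → letter P (i + p) ≡ letter P i)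
                (N : ℕ) (p≤N : p ≤ N) where
  open Dealing (letter P)
  private
    L = letter P

  c : ℕ
  c = countD L p

  M : ℕ
  M = N ∸ c

  relabelling : ℕ → ℕ
  relabelling = nth (deckAfter N p)

  run-after-period : ∀ t → run L 0 (p + t) (initial N)
                         ≡ relabel relabelling (positionsD p) (run L 0 t (initial M))
  run-after-period t = begin
    run L 0 (p + t) (initial N)                  ≡⟨ run-+ p t 0 (initial N) ⟩
    run L p t (run L 0 p (initial N))            ≡⟨ cong (run L p t) (run-initial N p p≤N) ⟩
    run L p t (deckAfter N p , positionsD p)     ≡⟨ run-periodic p periodic t 0 _ ⟩
    run L 0 t (deckAfter N p , positionsD p)     ≡⟨ cong (run L 0 t) (sym (relabel-initial _ _)) ⟩
    run L 0 t (relabelled (length (deckAfter N p)))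
                                                 ≡⟨ cong (λ n → run L 0 t (relabelled n)) (length-deckAfter p≤N) ⟩
    run L 0 t (relabelled M)                     ≡⟨ run-relabel relabelling (positionsD p) t 0 (initial M) ⟩
    relabel relabelling (positionsD p) (run L 0 t (initial M)) ∎
    where
      relabelled : ℕ → State
      relabelled n = relabel relabelling (positionsD p) (initial n)

  private
    horizon : ℕ
    horizon = dIdx P N + dIdx P M

    J-via-period : ∀ {k} → k ≤ N → J P N k ≡ nth (positionsD p ++ map relabelling (dealtAfter M horizon)) k
    J-via-period k≤N = trans (J-dealtAfter P k≤N (≤-trans (m≤m+n _ _) (m≤n+m horizon p)))
                            (cong (λ s → nth (dealt s) _) (run-after-period horizon))

  J-first-period : ∀ {k} → k ≤ c → k ≤ N → J P N k ≡ nth (positionsD p) k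
  J-first-period k≤c k≤N =
    trans (J-via-period k≤N) (nth-++ˡ (positionsD p) _ (subst (_ ≤_) (sym (length-positionsD p)) k≤c))

  J-later-period : ∀ {k} → c < k → k ≤ N → J P N k ≡ relabelling (J P M (k ∸ c))
  J-later-period {k} c<k k≤N = begin
    J P N k                                                  ≡⟨ J-via-period k≤N ⟩
    nth (positionsD p ++ map relabelling pile) k             ≡⟨ nth-++ʳ (positionsD p) _ (subst (_< k) (sym (length-positionsD p)) c<k) ⟩
    nth (map relabelling pile) (k ∸ length (positionsD p))   ≡⟨ cong (λ i → nth (map relabelling pile) (k ∸ i)) (length-positionsD p) ⟩
    nth (map relabelling pile) (k ∸ c)                       ≡⟨ nth-map relabelling (nth-zero (deckAfter N p)) pile (k ∸ c) ⟩
    relabelling (nth pile (k ∸ c))                           ≡⟨ cong relabelling (sym (J-dealtAfter P (∸-monoˡ-≤ c k≤N)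
                                                                                                (m≤n+m (dIdx P M) (dIdx P N)))) ⟩
    relabelling (J P M (k ∸ c))                              ∎
    where
      pile : List ℕ
      pile = dealtAfter M horizon

mainTheorem15 : (P : DealingPattern) (p : ℕ) → 1 ≤ p
                  → (∀ i → letter P (i + p) ≡ letter P i)
                  → ∀ N → p ≤ N → ∀ k → 1 ≤ k → k ≤ N
                  → (dIdx P k ≤ p → J P N k ≡ dIdx P k)
                    × (p < dIdx P k
                       → J P (N ∸ countD (letter P) p) (k ∸ countD (letter P) p) ≤ N ∸ p
                       → J P N k ≡ J P (N ∸ countD (letter P) p) (k ∸ countD (letter P) p) + p)
                    × (p < dIdx P k
                       → N ∸ p < J P (N ∸ countD (letter P) p) (k ∸ countD (letter P) p)
                       → IsUIdx (letter P) ((p + J P (N ∸ countD (letter P) p) (k ∸ countD (letter P) p)) ∸ N) (J P N k))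
mainTheorem15 P p _ periodic N p≤N zero    () _
mainTheorem15 P p _ periodic N p≤N (suc k) _  k≤N = first , kept , moved
  where
    open Dealing (letter P)
    open Periodic P p periodic N p≤N
    j : ℕ
    j = J P M (suc k ∸ c)

    j-range : p < dIdx P (suc k) → 1 ≤ j × j ≤ M
    j-range p<d = J-range P (m<n⇒0<n∸m (<dIdx⇒countD< P p<d)) (∸-monoˡ-≤ c k≤N)

    first : dIdx P (suc k) ≤ p → J P N (suc k) ≡ dIdx P (suc k)
    first d≤p = trans (J-first-period (dIdx≤⇒≤countD P d≤p) k≤N) (nth-positionsD-dIdx P d≤p)

    kept : p < dIdx P (suc k) → j ≤ N ∸ p → J P N (suc k) ≡ j + p
    kept p<d j≤ = trans (J-later-period (<dIdx⇒countD< P p<d) k≤N) (nth-deckAfter-kept (proj₁ (j-range p<d)) j≤)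

    moved : p < dIdx P (suc k) → N ∸ p < j → IsUIdx (letter P) ((p + j) ∸ N) (J P N (suc k))
    moved p<d j> = subst (IsUIdx (letter P) _) (sym (J-later-period (<dIdx⇒countD< P p<d) k≤N))
                     (nth-deckAfter-moved p≤N j> (proj₂ (j-range p<d)))
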